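{- Let $n\ge 8406$ and $k\ge0$ be integers, and let $(\tau_1,\tau_2,\tau_3,\tau_4,\mu,\iota)\in F(n,k)$. Then \[g_s(\tau_1,\tau_2,\tau_3,\tau_4,\mu,\iota)\le\max_j e\big(E_j(n,k)\big),\] the maximum being over those $j\in\{1,2,3,4\}$ for which $E_j(n,k)$ is defined.
   Context: $F(n,k)$ is the set of $(\tau_1,\tau_2,\tau_3,\tau_4,\mu,\iota)\in\mathbb N_0^6$ with $\tau_1+\tau_2+\tau_3+\tau_4=k$ and $2\mu+\iota=n-3k$ (so it is empty unless $3k\le n$). Define $f'(\tau_1,\dots,\tau_4,\mu,\iota)=4\mu\tau_1+2\iota\tau_1+7\binom{\tau_1}{2}+3\tau_1+2\iota\tau_2+8\binom{\tau_2}{2}+3\tau_2+8\binom{\tau_3}{2}+8\tau_3\tau_4+3\tau_3+7\tau_1\tau_2+(2+3\mu)\tau_2+7\tau_1(\tau_3+\tau_4)+(3+3\mu)\tau_3+8\tau_2(\tau_3+\tau_4)+(2+\iota)\tau_3$, and $f=f'$ if $\mu\ge1,\iota\ge1$; $f=f'-(2\tau_2+3\tau_3)$ if $\mu=0,\iota\ge1$; $f=f'-2\tau_3$ if $\mu\ge1,\iota=0$; $f=f'-(2\tau_2+5\tau_3)$ if $\mu=\iota=0$. Let $g_s=f(\tau_1,\tau_2,\tau_3,\tau_4,\mu,\iota)+\iota\mu+\mu^2+(3+3\mu)\tau_4+(2+\iota)\tau_4+8\binom{\tau_4}{2}+10\tau_4-28$. For $0\le k\le n/3$ the graphs $E_j(n,k)$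 on $n$ vertices are: $E_1$: parts $X,Y_1,Y_2$ with $|X|=k$, $|Y_1|=\lceil\frac{n-k}2\rceil$, $|Y_2|=\lfloor\frac{n-k}2\rfloor$, edges all pairs meeting $X$ and all $Y_1$–$Y_2$ pairs; $e(E_1)=\binom k2+k(n-k)+\lceil\frac{n-k}2\rceil\lfloor\frac{n-k}2\rfloor$. $E_2$ (defined only for $k<\frac{n-1}4$): parts $X,Y_1,Y_2$ with $|X|=2k+1$, $|Y_1|=\lfloor\frac n2\rfloor$, $|Y_2|=\lceil\frac n2\rceil-2k-1$ (or with floor and ceiling swapped), edges all pairs within $X$ and all pairs between $Y_1$ and $X\cup Y_2$; $e(E_2)=\binom{2k+1}2+\lceil\frac n2\rceil\lfloor\frac n2\rfloor$. $E_3$: parts $X,Y_1$ with $|X|=2k+1$, edges all pairs meeting $X$; $e(E_3)=\binom{2k+1}2+(2k+1)(n-2k-1)$. $E_4$ (defined only for $k\ge\frac n6-2$): $K_n$ if $k\ge\frac{n-2}3$, otherwise parts $X,Y_1,\dots,Y_4$ with $|Y_1|=|Y_3|$, $|Y_2|=|Y_4|$, $|Y_1|+|Y_2|=n-3k-2$, $|X|=6k-n+4$, edges all pairs within $X$, between $X$ and $Y_1\cup Y_2$, and between $Y_1\cup Y_4$ and $Y_2\cup Y_3$; $e(E_4)=\binom{6k-n+4}2+(6k-n+4)(n-3k-2)+(n-3k-2)^2$. -}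

module Defs where

open import Data.Nat as ℕ using (ℕ; zero; suc; _<ᵇ_; _≤ᵇ_)
open import Data.Integer as ℤ using (ℤ; +_; _+_; _*_; _-_; _⊔_; _/ℕ_)
open import Data.Bool using (if_then_else_)
open import Relation.Binary.PropositionalEquality using (_≡_)
open import Data.Product using (_×_)

-- binomial coefficient (x choose 2) = x(x-1)/2, for an integer x
-- (x(x-1) is always even, so the division is exact)
C2 : ℤ → ℤ
C2 x = (x * (x - + 1)) /ℕ 2

-- membership in F(n,k):  τ1+τ2+τ3+τ4 = k  and  2μ+ι = n-3k
-- (the latter stated without truncated subtraction as 2μ+ι+3k = n)
InF : (n k τ₁ τ₂ τ₃ τ₄ μ ι : ℕ) → Set
InF n k τ₁ τ₂ τ₃ τ₄ μ ι =
  (τ₁ ℕ.+ τ₂ ℕ.+ τ₃ ℕ.+ τ₄ ≡ k) × (2 ℕ.* μ ℕ.+ ι ℕ.+ 3 ℕ.* k ≡ n)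

f′ : (τ₁ τ₂ τ₃ τ₄ μ ι : ℕ) → ℤ
f′ τ₁' τ₂' τ₃' τ₄' μ' ι' =
    + 4 * μ * τ₁ + + 2 * ι * τ₁ + + 7 * C2 τ₁ + + 3 * τ₁
  + + 2 * ι * τ₂ + + 8 * C2 τ₂ + + 3 * τ₂
  + + 8 * C2 τ₃ + + 8 * τ₃ * τ₄ + + 3 * τ₃
  + + 7 * τ₁ * τ₂ + (+ 2 + + 3 * μ) * τ₂
  + + 7 * τ₁ * (τ₃ + τ₄) + (+ 3 + + 3 * μ) * τ₃
  + + 8 * τ₂ * (τ₃ + τ₄) + (+ 2 + ι) * τ₃
  where
  τ₁ = + τ₁' ; τ₂ = + τ₂' ; τ₃ = + τ₃' ; τ₄ = + τ₄' ; μ = + μ' ; ι = + ι'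

f : (τ₁ τ₂ τ₃ τ₄ μ ι : ℕ) → ℤ
f τ₁ τ₂ τ₃ τ₄ (suc μ) (suc ι) = f′ τ₁ τ₂ τ₃ τ₄ (suc μ) (suc ι)
f τ₁ τ₂ τ₃ τ₄ zero    (suc ι) = f′ τ₁ τ₂ τ₃ τ₄ zero (suc ι) - (+ 2 * + τ₂ + + 3 * + τ₃)
f τ₁ τ₂ τ₃ τ₄ (suc μ) zero    = f′ τ₁ τ₂ τ₃ τ₄ (suc μ) zero - + 2 * + τ₃
f τ₁ τ₂ τ₃ τ₄ zero    zero    = f′ τ₁ τ₂ τ₃ τ₄ zero zero - (+ 2 * + τ₂ + + 5 * + τ₃)

g-s : (τ₁ τ₂ τ₃ τ₄ μ ι : ℕ) → ℤ
g-s τ₁ τ₂ τ₃ τ₄ μ ι =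
  f τ₁ τ₂ τ₃ τ₄ μ ι + + ι * + μ + + μ * + μ
  + (+ 3 + + 3 * + μ) * + τ₄ + (+ 2 + + ι) * + τ₄
  + + 8 * C2 (+ τ₄) + + 10 * + τ₄ - + 28

⌊_/2⌋ : ℕ → ℕ
⌊ m /2⌋ = m ℕ./ 2

⌈_/2⌉ : ℕ → ℕ
⌈ m /2⌉ = (m ℕ.+ 1) ℕ./ 2

eE₁ : ℕ → ℕ → ℤ
eE₁ n k = C2 (+ k) + + k * (+ n - + k)
        + + ⌈ n ℕ.∸ k /2⌉ * + ⌊ n ℕ.∸ k /2⌋   -- n ∸ k is exact since 3k ≤ n

eE₂ : ℕ → ℕ → ℤ
eE₂ n k = C2 (+ (2 ℕ.* k ℕ.+ 1)) + + ⌈ n /2⌉ * + ⌊ n /2⌋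

eE₃ : ℕ → ℕ → ℤ
eE₃ n k = C2 (+ (2 ℕ.* k ℕ.+ 1)) + + (2 ℕ.* k ℕ.+ 1) * (+ n - + (2 ℕ.* k ℕ.+ 1))

eE₄ : ℕ → ℕ → ℤ
eE₄ n k =
  if n ≤ᵇ 3 ℕ.* k ℕ.+ 2                       -- k ≥ (n-2)/3 : E₄ = K_n
  then C2 (+ n)
  else C2 x + x * y + y * y
  where
  x = + 6 * + k - + n + + 4                    -- |X| = 6k-n+4
  y = + n - + 3 * + k - + 2                    -- |Y₁|+|Y₂| = n-3k-2

-- E₂ is defined iff k < (n-1)/4, i.e. 4k+1 < n
-- E₄ is defined iff k ≥ n/6 - 2, i.e. n ≤ 6k+12
-- maximum of e(E_j(n,k)) over the j for which E_j(n,k) is defined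
-- (E₁ and E₃ are always defined, so an undefined E_j is replaced by e(E₁))
maxE : ℕ → ℕ → ℤ
maxE n k =
  eE₁ n k ⊔ eE₃ n k
  ⊔ (if 4 ℕ.* k ℕ.+ 1 <ᵇ n then eE₂ n k else eE₁ n k)
  ⊔ (if n ≤ᵇ 6 ℕ.* k ℕ.+ 12 then eE₄ n k else eE₁ n k)

-- Doubling everything clears the binomial coefficients and turns the claim into polynomial
-- inequalities over ℤ, each proved by writing the gap as a manifestly nonnegative expression.
-- Dropping the τ₃-corrections of f and bounding the contribution of each unit of τ₂, τ₃, τ₄ by
-- the larger L of the marginal value of τ₂ and that of τ₃ and τ₄, twice g_s is at most a quadratic
-- Φ in τ₁ which is convex, hence at most its value at τ₁ = k or at τ₁ = 0.  The former is below
-- twice e(E₁) by AM–GM on the bipartite part of E₁.  The latter is below twice e(E₂) or e(E₃) when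
-- L comes from τ₂, and below twice e(E₄), e(E₁) or e(E₃) when it comes from τ₃ and τ₄, according
-- to the sizes of μ and ι; n ≥ 8406 only serves to make k large when E₄ is used.

module Submission where

open import Defs
open import Data.Bool using (true; false; if_then_else_; T)
open import Data.Integer
  using (ℤ; +_; -[1+_]; 0ℤ; _+_; _-_; -_; _*_; _≤_; _⊔_; _/ℕ_; +≤+; NonNegative; nonNegative)
open import Data.Integer.Properties
open import Data.Integer.Tactic.RingSolver using (solve-∀)
open import Data.Nat as ℕ using (ℕ; zero; suc; z≤n; s≤s)
import Data.Nat.Properties as ℕ
open import Data.Nat.DivMod using (m*n/n≡m; m/n≡1+[m∸n]/n)
open import Data.Product using (∃-syntax; _,_)
open import Data.Sum using (_⊎_; inj₁; inj₂)
open import Relation.Binary.PropositionalEquality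
open import Relation.Nullary using (yes; no)

≤-from-gap : ∀ {x y d} → y ≡ x + d → 0ℤ ≤ d → x ≤ y
≤-from-gap {x} {d = d} y≡x+d 0≤d =
  subst (x ≤_) (sym y≡x+d) (i≤i+j x d {{nonNegative 0≤d}})

0≤+ : ∀ n → 0ℤ ≤ + n
0≤+ _ = +≤+ z≤n

0≤i+j : ∀ {i j} → 0ℤ ≤ i → 0ℤ ≤ j → 0ℤ ≤ i + j
0≤i+j = +-mono-≤

0≤i*j : ∀ {i j} → 0ℤ ≤ i → 0ℤ ≤ j → 0ℤ ≤ i * j
0≤i*j {+ m} {+ n} _ _ = subst (0ℤ ≤_) (pos-* m n) (0≤+ (m ℕ.* n))

twice-mono : ∀ {i j} → i ≤ j → + 2 * i ≤ + 2 * j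
twice-mono = *-monoˡ-≤-nonNeg (+ 2)

n[n-1]-even : ∀ n → ∃[ q ] + n * (+ n - + 1) ≡ + (q ℕ.* 2)
n[n-1]-even zero    = 0 , refl
n[n-1]-even (suc n) with q , eq ← n[n-1]-even n = q ℕ.+ n , (begin
  (+ 1 + + n) * ((+ 1 + + n) - + 1) ≡⟨ step (+ n) ⟩
  + n * (+ n - + 1) + + n * + 2     ≡⟨ cong₂ _+_ eq (sym (pos-* n 2)) ⟩
  + (q ℕ.* 2 ℕ.+ n ℕ.* 2)           ≡⟨ cong +_ (sym (ℕ.*-distribʳ-+ 2 q n)) ⟩
  + ((q ℕ.+ n) ℕ.* 2)               ∎)
  where
  open ≡-Reasoning
  step : ∀ y → (+ 1 + y) * ((+ 1 + y) - + 1) ≡ y * (y - + 1) + y * + 2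
  step = solve-∀

x[x-1]-even : ∀ x → ∃[ q ] x * (x - + 1) ≡ + (q ℕ.* 2)
x[x-1]-even (+ n)    = n[n-1]-even n
x[x-1]-even -[1+ n ] with q , eq ← n[n-1]-even (suc (suc n)) =
  q , trans (reflect (+ suc n)) eq
  where
  reflect : ∀ y → (- y) * (- y - + 1) ≡ (+ 1 + y) * ((+ 1 + y) - + 1)
  reflect = solve-∀

twice-C2 : ∀ x → + 2 * C2 x ≡ x * (x - + 1)
twice-C2 x with q , eq ← x[x-1]-even x = begin
  + 2 * C2 x                     ≡⟨ cong (λ y → + 2 * (y /ℕ 2)) eq ⟩
  + 2 * + (q ℕ.* 2 ℕ./ 2)        ≡⟨ cong (λ y → + 2 * + y) (m*n/n≡m q 2) ⟩
  + 2 * + q                      ≡⟨ sym (pos-* 2 q) ⟩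
  + (2 ℕ.* q)                    ≡⟨ cong +_ (ℕ.*-comm 2 q) ⟩
  + (q ℕ.* 2)                    ≡⟨ sym eq ⟩
  x * (x - + 1)                  ∎
  where open ≡-Reasoning

0≤x[x-1] : ∀ x → 0ℤ ≤ x * (x - + 1)
0≤x[x-1] x with q , eq ← x[x-1]-even x = subst (0ℤ ≤_) (sym eq) (0≤+ (q ℕ.* 2))

⌊n/2⌋≡ : ∀ n → ⌊ n /2⌋ ≡ ℕ.⌊ n /2⌋
⌊n/2⌋≡ 0             = refl
⌊n/2⌋≡ 1             = refl
⌊n/2⌋≡ (suc (suc n)) =
  trans (m/n≡1+[m∸n]/n {suc (suc n)} {2} (s≤s (s≤s z≤n))) (cong suc (⌊n/2⌋≡ n))

⌈n/2⌉≡ : ∀ n → ⌈ n /2⌉ ≡ ℕ.⌈ n /2⌉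
⌈n/2⌉≡ n = trans (⌊n/2⌋≡ (n ℕ.+ 1)) (cong ℕ.⌊_/2⌋ (ℕ.+-comm n 1))

⌈n/2⌉≤1+⌊n/2⌋ : ∀ n → ℕ.⌈ n /2⌉ ℕ.≤ suc ℕ.⌊ n /2⌋
⌈n/2⌉≤1+⌊n/2⌋ 0             = z≤n
⌈n/2⌉≤1+⌊n/2⌋ 1             = s≤s z≤n
⌈n/2⌉≤1+⌊n/2⌋ (suc (suc n)) = s≤s (⌈n/2⌉≤1+⌊n/2⌋ n)

-- The gap (c - x) (f - x) is a product of two factors of the same sign.
balanced-product-max : ∀ c f x → f ℕ.≤ c → c ℕ.≤ suc f → + x * (+ c + + f - + x) ≤ + c * + f
balanced-product-max c f x f≤c c≤1+f with x ℕ.≤? f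
... | yes x≤f = ≤-from-gap (gap (+ c) (+ f) (+ x))
  (0≤i*j (i≤j⇒0≤j-i (+≤+ (ℕ.≤-trans x≤f f≤c))) (i≤j⇒0≤j-i (+≤+ x≤f)))
  where
  gap : ∀ c f x → c * f ≡ x * (c + f - x) + (c - x) * (f - x)
  gap = solve-∀
... | no x≰f = ≤-from-gap (gap (+ c) (+ f) (+ x))
  (0≤i*j (i≤j⇒0≤j-i (+≤+ (ℕ.≤-trans c≤1+f f<x))) (i≤j⇒0≤j-i (+≤+ (ℕ.<⇒≤ f<x))))
  where
  f<x = ℕ.≰⇒> x≰f
  gap : ∀ c f x → c * f ≡ x * (c + f - x) + (x - c) * (x - f)
  gap = solve-∀

halves-product-max : ∀ n x → + x * (+ n - + x) ≤ + ⌈ n /2⌉ * + ⌊ n /2⌋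
halves-product-max n x rewrite ⌈n/2⌉≡ n | ⌊n/2⌋≡ n =
  subst (λ m → + x * (+ m - + x) ≤ + ℕ.⌈ n /2⌉ * + ℕ.⌊ n /2⌋) c+f≡n
    (balanced-product-max ℕ.⌈ n /2⌉ ℕ.⌊ n /2⌋ x (ℕ.⌊n/2⌋≤⌈n/2⌉ n) (⌈n/2⌉≤1+⌊n/2⌋ n))
  where
  c+f≡n : ℕ.⌈ n /2⌉ ℕ.+ ℕ.⌊ n /2⌋ ≡ n
  c+f≡n = trans (ℕ.+-comm ℕ.⌈ n /2⌉ ℕ.⌊ n /2⌋) (ℕ.⌊n/2⌋+⌈n/2⌉≡n n)

twice-distrib₃ : ∀ a b c → + 2 * (a + b + c) ≡ + 2 * a + + 2 * b + + 2 * c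
twice-distrib₃ = solve-∀

+∸ : ∀ {m n} → n ℕ.≤ m → + (m ℕ.∸ n) ≡ + m - + n
+∸ {m} {n} n≤m = sym (trans (m-n≡m⊖n m n) (⊖-≥ n≤m))

+[2k+1] : ∀ k → + (2 ℕ.* k ℕ.+ 1) ≡ + 2 * + k + + 1
+[2k+1] k = cong (_+ + 1) (pos-* 2 k)

-- Twice e(E₁), e(E₂), e(E₃) for N vertices, the complete bipartite part of E₁ and E₂ split as
-- x against the rest instead of evenly.
lowerE₁ : (N k x : ℤ) → ℤ
lowerE₁ N k x = k * (k - + 1) + + 2 * (k * (N - k)) + + 2 * (x * (N - k - x))

lowerE₂ : (N k x : ℤ) → ℤ
lowerE₂ N k x = (+ 2 * k + + 1) * ((+ 2 * k + + 1) - + 1) + + 2 * (x * (N - x))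

twiceE₃ : (N k : ℤ) → ℤ
twiceE₃ N k =
  (+ 2 * k + + 1) * ((+ 2 * k + + 1) - + 1) + + 2 * ((+ 2 * k + + 1) * (N - (+ 2 * k + + 1)))

twice-eE₁≥ : ∀ n k x → k ℕ.≤ n → lowerE₁ (+ n) (+ k) (+ x) ≤ + 2 * eE₁ n k
twice-eE₁≥ n k x k≤n = begin
  lowerE₁ N K X                       ≤⟨ +-monoʳ-≤ (K * (K - + 1) + B) (twice-mono split≤H) ⟩
  K * (K - + 1) + B + + 2 * H         ≡⟨ cong (λ y → y + B + + 2 * H) (sym (twice-C2 K)) ⟩
  + 2 * C2 K + B + + 2 * H            ≡⟨ sym (twice-distrib₃ (C2 K) (K * (N - K)) H) ⟩
  + 2 * eE₁ n k                       ∎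
  where
  open ≤-Reasoning
  N = + n
  K = + k
  X = + x
  B = + 2 * (K * (N - K))
  H = + ⌈ n ℕ.∸ k /2⌉ * + ⌊ n ℕ.∸ k /2⌋
  split≤H : X * (N - K - X) ≤ H
  split≤H = subst (λ m → X * (m - X) ≤ H) (+∸ k≤n) (halves-product-max (n ℕ.∸ k) x)

twice-eE₂≥ : ∀ n k x → lowerE₂ (+ n) (+ k) (+ x) ≤ + 2 * eE₂ n k
twice-eE₂≥ n k x = begin
  lowerE₂ N K X
    ≡⟨ cong (λ c → c * (c - + 1) + + 2 * (X * (N - X))) (sym (+[2k+1] k)) ⟩
  C * (C - + 1) + + 2 * (X * (N - X))
    ≤⟨ +-monoʳ-≤ (C * (C - + 1)) (twice-mono (halves-product-max n x)) ⟩
  C * (C - + 1) + + 2 * H              ≡⟨ cong (_+ + 2 * H) (sym (twice-C2 C)) ⟩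
  + 2 * C2 C + + 2 * H                 ≡⟨ sym (*-distribˡ-+ (+ 2) (C2 C) H) ⟩
  + 2 * eE₂ n k                        ∎
  where
  open ≤-Reasoning
  N = + n
  K = + k
  X = + x
  C = + (2 ℕ.* k ℕ.+ 1)
  H = + ⌈ n /2⌉ * + ⌊ n /2⌋

twice-eE₃≡ : ∀ n k → + 2 * eE₃ n k ≡ twiceE₃ (+ n) (+ k)
twice-eE₃≡ n k = begin
  + 2 * eE₃ n k                        ≡⟨ *-distribˡ-+ (+ 2) (C2 C) (C * (N - C)) ⟩
  + 2 * C2 C + + 2 * (C * (N - C))     ≡⟨ cong (_+ + 2 * (C * (N - C))) (twice-C2 C) ⟩
  C * (C - + 1) + + 2 * (C * (N - C))
    ≡⟨ cong (λ c → c * (c - + 1) + + 2 * (c * (N - c))) (+[2k+1] k) ⟩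
  twiceE₃ N (+ k)                      ∎
  where
  open ≡-Reasoning
  N = + n
  C = + (2 ℕ.* k ℕ.+ 1)

twice-eE₄≥ : ∀ n k → 3 ℕ.* k ℕ.≤ n → + 9 * + k * + k - + 3 * + k ≤ + 2 * eE₄ n k
twice-eE₄≥ n k 3k≤n = by-cases (n ℕ.≤ᵇ 3 ℕ.* k ℕ.+ 2) complete partite
  where
  N = + n
  K = + k
  bound = + 9 * K * K - + 3 * K
  by-cases : ∀ b {e e′} → bound ≤ + 2 * e → bound ≤ + 2 * e′ →
    bound ≤ + 2 * (if b then e else e′)
  by-cases true  p _ = p
  by-cases false _ q = q
  3K≤N : + 3 * K ≤ N
  3K≤N = subst (_≤ N) (pos-* 3 k) (+≤+ 3k≤n)
  complete : bound ≤ + 2 * C2 N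
  complete = subst (bound ≤_) (sym (twice-C2 N)) (≤-from-gap (gap N K)
    (0≤i+j (0≤i*j (0≤i*j (0≤+ 6) (0≤+ k)) (i≤j⇒0≤j-i 3K≤N)) (0≤x[x-1] (N - + 3 * K))))
    where
    gap : ∀ N K → N * (N - + 1) ≡
      (+ 9 * K * K - + 3 * K) + (+ 6 * K * (N - + 3 * K) + (N - + 3 * K) * ((N - + 3 * K) - + 1))
    gap = solve-∀
  X = + 6 * K - N + + 4
  Y = N - + 3 * K - + 2
  partite : bound ≤ + 2 * (C2 X + X * Y + Y * Y)
  partite = begin
    bound                                          ≤⟨ ≤-from-gap (gap N K) 12K+2+z[z-1]≥0 ⟩
    X * (X - + 1) + + 2 * (X * Y) + + 2 * (Y * Y)
      ≡⟨ cong (λ y → y + + 2 * (X * Y) + + 2 * (Y * Y)) (sym (twice-C2 X)) ⟩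
    + 2 * C2 X + + 2 * (X * Y) + + 2 * (Y * Y)     ≡⟨ sym (twice-distrib₃ (C2 X) (X * Y) (Y * Y)) ⟩
    + 2 * (C2 X + X * Y + Y * Y)                   ∎
    where
    open ≤-Reasoning
    12K+2+z[z-1]≥0 =
      0≤i+j (0≤i+j (0≤i*j (0≤+ 12) (0≤+ k)) (0≤+ 2)) (0≤x[x-1] (N - + 3 * K - + 1))
    gap : ∀ N K →
      (+ 6 * K - N + + 4) * ((+ 6 * K - N + + 4) - + 1)
        + + 2 * ((+ 6 * K - N + + 4) * (N - + 3 * K - + 2))
        + + 2 * ((N - + 3 * K - + 2) * (N - + 3 * K - + 2))
      ≡ (+ 9 * K * K - + 3 * K) + (+ 12 * K + + 2 + (N - + 3 * K - + 1) * ((N - + 3 * K - + 1) - + 1))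
    gap = solve-∀

-- A convex quadratic bound for g_s

τ₂-penalty : ℕ → ℤ
τ₂-penalty zero    = + 2
τ₂-penalty (suc _) = 0ℤ

slope₂ : (p μ ι : ℤ) → ℤ
slope₂ p μ ι = + 3 * μ + + 2 * ι + + 5 - p

slope₃ : (μ ι : ℤ) → ℤ
slope₃ μ ι = + 3 * μ + ι + + 15

slope : ℕ → ℕ → ℤ
slope μ ι = slope₂ (τ₂-penalty μ) (+ μ) (+ ι) ⊔ slope₃ (+ μ) (+ ι)

-- Twice an upper bound for g_s when τ₁ = a and each of the k - a units of τ₂ + τ₃ + τ₄ contributes
-- at most L (slope₂ for τ₂, slope₃ for τ₃ and τ₄).  Φ₀ and Φ₁ are its values at a = 0 and a = k.
Φ : (k a L μ ι : ℤ) → ℤ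
Φ k a L μ ι = + 8 * k * (k - + 1) - a * (a - + 1) - + 2 * a * (k - a)
  + + 2 * a * (+ 4 * μ + + 2 * ι + + 3) + + 2 * (k - a) * L + + 2 * μ * (μ + ι) - + 56

Φ₀ : (k L μ ι : ℤ) → ℤ
Φ₀ k L μ ι = + 8 * k * (k - + 1) + + 2 * k * L + + 2 * μ * (μ + ι) - + 56

Φ₁ : (k μ ι : ℤ) → ℤ
Φ₁ k μ ι = + 7 * k * (k - + 1) + + 2 * k * (+ 4 * μ + + 2 * ι + + 3) + + 2 * μ * (μ + ι) - + 56

i-[j+k]≤i-j : ∀ i j {k} → 0ℤ ≤ k → i - (j + k) ≤ i - j
i-[j+k]≤i-j i j {k} 0≤k = ≤-from-gap (gap i j k) 0≤k
  where
  gap : ∀ i j k → i - j ≡ i - (j + k) + k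
  gap = solve-∀

f≤f′-penalty : ∀ τ₁ τ₂ τ₃ τ₄ μ ι →
  f τ₁ τ₂ τ₃ τ₄ μ ι ≤ f′ τ₁ τ₂ τ₃ τ₄ μ ι - τ₂-penalty μ * + τ₂
f≤f′-penalty τ₁ τ₂ τ₃ τ₄ μ@(suc _) ι@(suc _) = i≤i+j (f′ τ₁ τ₂ τ₃ τ₄ μ ι) (+ 0)
f≤f′-penalty τ₁ τ₂ τ₃ τ₄ zero      ι@(suc _) =
  i-[j+k]≤i-j (f′ τ₁ τ₂ τ₃ τ₄ 0 ι) (+ 2 * + τ₂) (0≤i*j (0≤+ 3) (0≤+ τ₃))
f≤f′-penalty τ₁ τ₂ τ₃ τ₄ μ@(suc _) zero      = ≤-trans
  (i-j≤i (f′ τ₁ τ₂ τ₃ τ₄ μ 0) (+ 2 * + τ₃) {{nonNegative (0≤i*j (0≤+ 2) (0≤+ τ₃))}})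
  (i≤i+j (f′ τ₁ τ₂ τ₃ τ₄ μ 0) (+ 0))
f≤f′-penalty τ₁ τ₂ τ₃ τ₄ zero      zero      =
  i-[j+k]≤i-j (f′ τ₁ τ₂ τ₃ τ₄ 0 0) (+ 2 * + τ₂) (0≤i*j (0≤+ 5) (0≤+ τ₃))

x[x-1]-2C2≡0 : ∀ x → x * (x - + 1) - + 2 * C2 x ≡ 0ℤ
x[x-1]-2C2≡0 x = trans (cong (_- + 2 * C2 x) (sym (twice-C2 x))) (+-inverseʳ (+ 2 * C2 x))

twice-g-s≤Φ : ∀ τ₁ τ₂ τ₃ τ₄ μ ι {L} →
  slope₂ (τ₂-penalty μ) (+ μ) (+ ι) ≤ L → slope₃ (+ μ) (+ ι) ≤ L →
  + 2 * g-s τ₁ τ₂ τ₃ τ₄ μ ι ≤ Φ (+ (τ₁ ℕ.+ τ₂ ℕ.+ τ₃ ℕ.+ τ₄)) (+ τ₁) L (+ μ) (+ ι)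
twice-g-s≤Φ τ₁ τ₂ τ₃ τ₄ μ ι {L} slope₂≤L slope₃≤L =
  ≤-from-gap
    (expand a b c d (+ μ) (+ ι) (τ₂-penalty μ) L (f τ₁ τ₂ τ₃ τ₄ μ ι) (C2 a) (C2 b) (C2 c) (C2 d))
    (0≤i+j (0≤i+j (0≤i+j (0≤i+j
      (0≤i*j (0≤+ 2) (i≤j⇒0≤j-i (f≤f′-penalty τ₁ τ₂ τ₃ τ₄ μ ι)))
      (0≤i*j (0≤+ 14) (0≤+ τ₃)))
      (0≤i*j (0≤i*j (0≤+ 2) (0≤+ τ₂)) (i≤j⇒0≤j-i slope₂≤L)))
      (0≤i*j (0≤i*j (0≤+ 2) (0≤+ (τ₃ ℕ.+ τ₄))) (i≤j⇒0≤j-i slope₃≤L)))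
      (≤-reflexive (sym C2-errors≡0)))
  where
  a = + τ₁
  b = + τ₂
  c = + τ₃
  d = + τ₄
  weighted-zero : ∀ {w x y z} → w ≡ 0ℤ → x ≡ 0ℤ → y ≡ 0ℤ → z ≡ 0ℤ →
    + 7 * w + + 8 * x + + 8 * y + + 8 * z ≡ 0ℤ
  weighted-zero refl refl refl refl = refl
  C2-errors≡0 : + 7 * (a * (a - + 1) - + 2 * C2 a) + + 8 * (b * (b - + 1) - + 2 * C2 b)
    + + 8 * (c * (c - + 1) - + 2 * C2 c) + + 8 * (d * (d - + 1) - + 2 * C2 d) ≡ 0ℤ
  C2-errors≡0 =
    weighted-zero (x[x-1]-2C2≡0 a) (x[x-1]-2C2≡0 b) (x[x-1]-2C2≡0 c) (x[x-1]-2C2≡0 d)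
  -- P, Q, R, S stand for the binomial coefficients C2 a, …, C2 d and F for f.
  expand : ∀ (a b c d μ ι p L F P Q R S : ℤ) →
    + 8 * (a + b + c + d) * ((a + b + c + d) - + 1) - a * (a - + 1)
      - + 2 * a * ((a + b + c + d) - a) + + 2 * a * (+ 4 * μ + + 2 * ι + + 3)
      + + 2 * ((a + b + c + d) - a) * L + + 2 * μ * (μ + ι) - + 56
    ≡ + 2 * (F + ι * μ + μ * μ + (+ 3 + + 3 * μ) * d + (+ 2 + ι) * d + + 8 * S + + 10 * d - + 28)
      + (+ 2 * (+ 4 * μ * a + + 2 * ι * a + + 7 * P + + 3 * a + + 2 * ι * b + + 8 * Q + + 3 * b
                + + 8 * R + + 8 * c * d + + 3 * c + + 7 * a * b + (+ 2 + + 3 * μ) * b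
                + + 7 * a * (c + d) + (+ 3 + + 3 * μ) * c + + 8 * b * (c + d) + (+ 2 + ι) * c
                - p * b - F)
        + + 14 * c
        + + 2 * b * (L - (+ 3 * μ + + 2 * ι + + 5 - p))
        + + 2 * (c + d) * (L - (+ 3 * μ + ι + + 15))
        + (+ 7 * (a * (a - + 1) - + 2 * P) + + 8 * (b * (b - + 1) - + 2 * Q)
           + + 8 * (c * (c - + 1) - + 2 * R) + + 8 * (d * (d - + 1) - + 2 * S)))
  expand = solve-∀

Φ-convex : ∀ {k a} L μ ι → 0ℤ ≤ a → a ≤ k →
  Φ k a L μ ι ≤ Φ₀ k L μ ι ⊎ Φ k a L μ ι ≤ Φ₁ k μ ι
Φ-convex {k} {a} L μ ι 0≤a a≤k with ≤-total (a - + 2 * k + (+ 8 * μ + + 4 * ι + + 7 - + 2 * L)) 0ℤ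
... | inj₁ s≤0 = inj₁ (≤-from-gap (toΦ₀ k a L μ ι) (0≤i*j 0≤a (i≤j⇒0≤j-i s≤0)))
  where
  toΦ₀ : ∀ k a L μ ι →
    + 8 * k * (k - + 1) + + 2 * k * L + + 2 * μ * (μ + ι) - + 56
    ≡ (+ 8 * k * (k - + 1) - a * (a - + 1) - + 2 * a * (k - a) + + 2 * a * (+ 4 * μ + + 2 * ι + + 3)
         + + 2 * (k - a) * L + + 2 * μ * (μ + ι) - + 56)
      + a * (0ℤ - (a - + 2 * k + (+ 8 * μ + + 4 * ι + + 7 - + 2 * L)))
  toΦ₀ = solve-∀
... | inj₂ 0≤s =
  inj₂ (≤-from-gap (toΦ₁ k a L μ ι) (0≤i*j (i≤j⇒0≤j-i a≤k) (0≤i+j 0≤s (≤-trans 0≤a a≤k))))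
  where
  toΦ₁ : ∀ k a L μ ι →
    + 7 * k * (k - + 1) + + 2 * k * (+ 4 * μ + + 2 * ι + + 3) + + 2 * μ * (μ + ι) - + 56
    ≡ (+ 8 * k * (k - + 1) - a * (a - + 1) - + 2 * a * (k - a) + + 2 * a * (+ 4 * μ + + 2 * ι + + 3)
         + + 2 * (k - a) * L + + 2 * μ * (μ + ι) - + 56)
      + (k - a) * ((a - + 2 * k + (+ 8 * μ + + 4 * ι + + 7 - + 2 * L)) + k)
  toΦ₁ = solve-∀

-- Comparing the endpoints of Φ with the extremal graphs

0≤3i⇒0≤i : ∀ {i} → 0ℤ ≤ + 3 * i → 0ℤ ≤ i
0≤3i⇒0≤i {i} = *-cancelˡ-≤-pos 0ℤ i (+ 3)

Φ₀-slope₂≤twiceE₃-at-μ=0 : ∀ (k ι : ℤ) .{{_ : NonNegative k}} .{{_ : NonNegative ι}} {N} →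
  N ≡ + 2 * 0ℤ + ι + + 3 * k → Φ₀ k (slope₂ (+ 2) 0ℤ ι) 0ℤ ι ≤ twiceE₃ N k
Φ₀-slope₂≤twiceE₃-at-μ=0 k ι refl =
  ≤-from-gap (gap k ι)
    (0≤i*j (0≤+ 2) (0≤i+j (0≤i+j (nonNegative⁻¹ ι) (nonNegative⁻¹ k)) (0≤+ 27)))
  where
  gap : ∀ k ι →
    (+ 2 * k + + 1) * ((+ 2 * k + + 1) - + 1)
      + + 2 * ((+ 2 * k + + 1) * ((+ 2 * 0ℤ + ι + + 3 * k) - (+ 2 * k + + 1)))
    ≡ (+ 8 * k * (k - + 1) + + 2 * k * (+ 3 * 0ℤ + + 2 * ι + + 5 - + 2) + + 2 * 0ℤ * (0ℤ + ι) - + 56)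
      + + 2 * (ι + k + + 27)
  gap = solve-∀

module _ (k μ ι : ℤ) .{{_ : NonNegative k}} .{{_ : NonNegative μ}} .{{_ : NonNegative ι}} where

  private
    k≥0 : 0ℤ ≤ k
    k≥0 = nonNegative⁻¹ k
    μ≥0 : 0ℤ ≤ μ
    μ≥0 = nonNegative⁻¹ μ
    ι≥0 : 0ℤ ≤ ι
    ι≥0 = nonNegative⁻¹ ι

  Φ₁≤lowerE₁ : ∀ {N} → N ≡ + 2 * μ + ι + + 3 * k → Φ₁ k μ ι ≤ lowerE₁ N k (μ + k)
  Φ₁≤lowerE₁ refl = ≤-from-gap (gap k μ ι) (0≤+ 56)
    where
    gap : ∀ k μ ι →
      k * (k - + 1) + + 2 * (k * ((+ 2 * μ + ι + + 3 * k) - k))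
        + + 2 * ((μ + k) * ((+ 2 * μ + ι + + 3 * k) - k - (μ + k)))
      ≡ (+ 7 * k * (k - + 1) + + 2 * k * (+ 4 * μ + + 2 * ι + + 3) + + 2 * μ * (μ + ι) - + 56) + + 56
    gap = solve-∀

  Φ₀-slope₂≤lowerE₂ : ∀ {N p} → N ≡ + 2 * μ + ι + + 3 * k → 0ℤ ≤ p →
    Φ₀ k (slope₂ p μ ι) μ ι ≤ lowerE₂ N k (μ + k + k)
  Φ₀-slope₂≤lowerE₂ {p = p} refl p≥0 =
    ≤-from-gap (gap k μ ι p) (0≤i+j (0≤i*j (0≤i*j (0≤+ 2) p≥0) k≥0) (0≤+ 56))
    where
    gap : ∀ k μ ι p →
      (+ 2 * k + + 1) * ((+ 2 * k + + 1) - + 1)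
        + + 2 * ((μ + k + k) * ((+ 2 * μ + ι + + 3 * k) - (μ + k + k)))
      ≡ (+ 8 * k * (k - + 1) + + 2 * k * (+ 3 * μ + + 2 * ι + + 5 - p) + + 2 * μ * (μ + ι) - + 56)
        + (+ 2 * p * k + + 56)
    gap = solve-∀

  Φ₀-slope₂≤twiceE₃ : ∀ {N} → N ≡ + 2 * μ + ι + + 3 * k → + 1 ≤ μ → + 2 * μ + ι ≤ k + + 2 →
    Φ₀ k (slope₂ 0ℤ μ ι) μ ι ≤ twiceE₃ N k
  Φ₀-slope₂≤twiceE₃ refl 1≤μ m≤k+2 = ≤-from-gap (gap k μ ι)
    (0≤i*j (0≤+ 2) (0≤i+j (0≤i+j (0≤+ 28) (0≤i*j μ-1≥0 μ-1≥0)) (0≤i*j (i≤j⇒0≤j-i m≤k+2) μ-1≥0)))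
    where
    μ-1≥0 = i≤j⇒0≤j-i 1≤μ
    gap : ∀ k μ ι →
      (+ 2 * k + + 1) * ((+ 2 * k + + 1) - + 1)
        + + 2 * ((+ 2 * k + + 1) * ((+ 2 * μ + ι + + 3 * k) - (+ 2 * k + + 1)))
      ≡ (+ 8 * k * (k - + 1) + + 2 * k * (+ 3 * μ + + 2 * ι + + 5 - 0ℤ) + + 2 * μ * (μ + ι) - + 56)
        + + 2 * (+ 28 + (μ - + 1) * (μ - + 1) + ((k + + 2) - (+ 2 * μ + ι)) * (μ - + 1))
    gap = solve-∀

  -- For μ + ι ≤ 43, k is large: 3 (k - 2(μ + ι)) and 3 (k - 25 - 7μ - 3ι) exceed N - 8406.
  Φ₀-slope₃≤lowerE₄ : ∀ {N} → N ≡ + 2 * μ + ι + + 3 * k → μ + ι ≤ + 43 → + 8406 ≤ N →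
    Φ₀ k (slope₃ μ ι) μ ι ≤ + 9 * k * k - + 3 * k
  Φ₀-slope₃≤lowerE₄ refl s≤43 N≥8406 = ≤-from-gap (gap k μ ι)
    (0≤i+j (0≤i+j (0≤i+j (0≤i+j
      (0≤i*j (0≤i*j (0≤+ 2) s≥0) y≥0) (0≤i*j x≥0 s≥0)) (0≤i*j x≥0 y≥0))
      (0≤i*j (0≤i*j (0≤+ 2) ι≥0) s≥0)) (0≤+ 56))
    where
    s≥0 = 0≤i+j μ≥0 ι≥0
    N-8406≥0 = i≤j⇒0≤j-i N≥8406
    43-s≥0 = i≤j⇒0≤j-i s≤43
    x≥0 : 0ℤ ≤ k - + 2 * (μ + ι)
    x≥0 = 0≤3i⇒0≤i (subst (0ℤ ≤_) (sym (3x≡ k μ ι))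
      (0≤i+j (0≤i+j (0≤i+j N-8406≥0 (0≤i*j (0≤+ 8) 43-s≥0)) ι≥0) (0≤+ 8062)))
      where
      3x≡ : ∀ k μ ι → + 3 * (k - + 2 * (μ + ι))
        ≡ ((+ 2 * μ + ι + + 3 * k) - + 8406) + + 8 * (+ 43 - (μ + ι)) + ι + + 8062
      3x≡ = solve-∀
    y≥0 : 0ℤ ≤ k - + 25 - + 7 * μ - + 3 * ι
    y≥0 = 0≤3i⇒0≤i (subst (0ℤ ≤_) (sym (3y≡ k μ ι))
      (0≤i+j (0≤i+j (0≤i+j N-8406≥0 (0≤i*j (0≤+ 23) 43-s≥0)) (0≤i*j (0≤+ 13) ι≥0)) (0≤+ 7342)))
      where
      3y≡ : ∀ k μ ι → + 3 * (k - + 25 - + 7 * μ - + 3 * ι)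
        ≡ ((+ 2 * μ + ι + + 3 * k) - + 8406) + + 23 * (+ 43 - (μ + ι)) + + 13 * ι + + 7342
      3y≡ = solve-∀
    gap : ∀ k μ ι → + 9 * k * k - + 3 * k ≡
      (+ 8 * k * (k - + 1) + + 2 * k * (+ 3 * μ + ι + + 15) + + 2 * μ * (μ + ι) - + 56)
        + (+ 2 * (μ + ι) * (k - + 25 - + 7 * μ - + 3 * ι) + (k - + 2 * (μ + ι)) * (μ + ι)
           + (k - + 2 * (μ + ι)) * (k - + 25 - + 7 * μ - + 3 * ι) + + 2 * ι * (μ + ι) + + 56)
    gap = solve-∀

  Φ₀-slope₃≤lowerE₁ : ∀ {N} → N ≡ + 2 * μ + ι + + 3 * k → k + + 23 ≤ + 2 * μ + + 2 * ι →
    Φ₀ k (slope₃ μ ι) μ ι ≤ lowerE₁ N k (μ + k)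
  Φ₀-slope₃≤lowerE₁ refl k+23≤2s =
    ≤-from-gap (gap k μ ι) (0≤i+j (0≤i*j k≥0 (i≤j⇒0≤j-i k+23≤2s)) (0≤+ 56))
    where
    gap : ∀ k μ ι →
      k * (k - + 1) + + 2 * (k * ((+ 2 * μ + ι + + 3 * k) - k))
        + + 2 * ((μ + k) * ((+ 2 * μ + ι + + 3 * k) - k - (μ + k)))
      ≡ (+ 8 * k * (k - + 1) + + 2 * k * (+ 3 * μ + ι + + 15) + + 2 * μ * (μ + ι) - + 56)
        + (k * ((+ 2 * μ + + 2 * ι) - (k + + 23)) + + 56)
    gap = solve-∀

  Φ₀-slope₃≤twiceE₃ : ∀ {N} → N ≡ + 2 * μ + ι + + 3 * k → + 43 ≤ μ + ι →
    + 2 * μ + + 2 * ι ≤ k + + 23 → Φ₀ k (slope₃ μ ι) μ ι ≤ twiceE₃ N k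
  Φ₀-slope₃≤twiceE₃ refl 43≤s 2s≤k+23 = ≤-from-gap (gap k μ ι)
    (0≤i*j (0≤+ 2) (0≤i+j (0≤i+j (0≤i+j
      (0≤i*j ι≥0 (0≤i+j s-43≥0 (0≤+ 42)))
      (0≤i*j (0≤i+j μ≥0 ι≥0) s-43≥0))
      (0≤i*j (i≤j⇒0≤j-i 2s≤k+23) (0≤i+j s-43≥0 (0≤+ 32))))
      (0≤+ 280)))
    where
    s-43≥0 = i≤j⇒0≤j-i 43≤s
    gap : ∀ k μ ι →
      (+ 2 * k + + 1) * ((+ 2 * k + + 1) - + 1)
        + + 2 * ((+ 2 * k + + 1) * ((+ 2 * μ + ι + + 3 * k) - (+ 2 * k + + 1)))
      ≡ (+ 8 * k * (k - + 1) + + 2 * k * (+ 3 * μ + ι + + 15) + + 2 * μ * (μ + ι) - + 56)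
        + + 2 * (ι * (((μ + ι) - + 43) + + 42) + (μ + ι) * ((μ + ι) - + 43)
                 + ((k + + 23) - (+ 2 * μ + + 2 * ι)) * (((μ + ι) - + 43) + + 32) + + 280)
    gap = solve-∀

  E₂-defined : ∀ {N} → N ≡ + 2 * μ + ι + + 3 * k → k + + 2 ≤ + 2 * μ + ι → + 4 * k + + 2 ≤ N
  E₂-defined refl k+2≤m = ≤-from-gap (gap k μ ι) (i≤j⇒0≤j-i k+2≤m)
    where
    gap : ∀ k μ ι → + 2 * μ + ι + + 3 * k ≡ (+ 4 * k + + 2) + ((+ 2 * μ + ι) - (k + + 2))
    gap = solve-∀

  E₄-defined : ∀ {N} → N ≡ + 2 * μ + ι + + 3 * k → μ + ι ≤ + 43 → + 8406 ≤ N → N ≤ + 6 * k + + 12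
  E₄-defined refl s≤43 N≥8406 = ≤-from-gap (gap k μ ι)
    (0≤i+j (0≤i+j (0≤i+j (i≤j⇒0≤j-i N≥8406) (0≤i*j (0≤+ 4) (i≤j⇒0≤j-i s≤43)))
      (0≤i*j (0≤+ 2) ι≥0)) (0≤+ 8246))
    where
    gap : ∀ k μ ι → + 6 * k + + 12 ≡ (+ 2 * μ + ι + + 3 * k)
      + (((+ 2 * μ + ι + + 3 * k) - + 8406) + + 4 * (+ 43 - (μ + ι)) + + 2 * ι + + 8246)
    gap = solve-∀

if-true : ∀ {A : Set} {b} {x y : A} → T b → (if b then x else y) ≡ x
if-true {b = true} _ = refl

lowerE₁≤twice-maxE : ∀ n k x → k ℕ.≤ n → lowerE₁ (+ n) (+ k) (+ x) ≤ + 2 * maxE n k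
lowerE₁≤twice-maxE n k x k≤n = ≤-trans (twice-eE₁≥ n k x k≤n)
  (twice-mono (i≤j⇒i≤j⊔k _ (i≤j⇒i≤j⊔k _ (i≤i⊔j (eE₁ n k) (eE₃ n k)))))

lowerE₂≤twice-maxE : ∀ n k x → + 4 * + k + + 2 ≤ + n →
  lowerE₂ (+ n) (+ k) (+ x) ≤ + 2 * maxE n k
lowerE₂≤twice-maxE n k x 4k+2≤n = ≤-trans (twice-eE₂≥ n k x)
  (twice-mono (i≤j⇒i≤j⊔k _ (i≤j⇒i≤k⊔j _ (≤-reflexive (sym (if-true (ℕ.<⇒<ᵇ 4k+1<n)))))))
  where
  4k+1<n : 4 ℕ.* k ℕ.+ 1 ℕ.< n
  4k+1<n = subst (ℕ._≤ n) (ℕ.+-suc (4 ℕ.* k) 1)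
    (drop‿+≤+ (subst (λ x → x + + 2 ≤ + n) (sym (pos-* 4 k)) 4k+2≤n))

twiceE₃≤twice-maxE : ∀ n k → twiceE₃ (+ n) (+ k) ≤ + 2 * maxE n k
twiceE₃≤twice-maxE n k = subst (_≤ + 2 * maxE n k) (twice-eE₃≡ n k)
  (twice-mono (i≤j⇒i≤j⊔k _ (i≤j⇒i≤j⊔k _ (i≤j⊔i (eE₁ n k) (eE₃ n k)))))

lowerE₄≤twice-maxE : ∀ n k → 3 ℕ.* k ℕ.≤ n → + n ≤ + 6 * + k + + 12 →
  + 9 * + k * + k - + 3 * + k ≤ + 2 * maxE n k
lowerE₄≤twice-maxE n k 3k≤n n≤6k+12 = ≤-trans (twice-eE₄≥ n k 3k≤n)
  (twice-mono (i≤j⇒i≤k⊔j _ (≤-reflexive (sym (if-true (ℕ.≤⇒≤ᵇ n≤6k+12′))))))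
  where
  n≤6k+12′ : n ℕ.≤ 6 ℕ.* k ℕ.+ 12
  n≤6k+12′ = drop‿+≤+ (subst (λ x → + n ≤ x + + 12) (sym (pos-* 6 k)) n≤6k+12)

order : ℕ → ℕ → ℕ → ℕ
order μ ι k = 2 ℕ.* μ ℕ.+ ι ℕ.+ 3 ℕ.* k

+order : ∀ μ ι k → + order μ ι k ≡ + 2 * + μ + + ι + + 3 * + k
+order μ ι k = cong₂ (λ x y → x + + ι + y) (pos-* 2 μ) (pos-* 3 k)

3k≤order : ∀ μ ι k → 3 ℕ.* k ℕ.≤ order μ ι k
3k≤order μ ι k = ℕ.m≤n+m (3 ℕ.* k) (2 ℕ.* μ ℕ.+ ι)

k≤order : ∀ μ ι k → k ℕ.≤ order μ ι k
k≤order μ ι k = ℕ.≤-trans (ℕ.m≤n*m k 3) (3k≤order μ ι k)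

Φ₁≤twice-maxE : ∀ μ ι k → Φ₁ (+ k) (+ μ) (+ ι) ≤ + 2 * maxE (order μ ι k) k
Φ₁≤twice-maxE μ ι k = ≤-trans (Φ₁≤lowerE₁ (+ k) (+ μ) (+ ι) (+order μ ι k))
  (lowerE₁≤twice-maxE (order μ ι k) k (μ ℕ.+ k) (k≤order μ ι k))

Φ₀-slope₂≤twice-maxE : ∀ μ ι k →
  Φ₀ (+ k) (slope₂ (τ₂-penalty μ) (+ μ) (+ ι)) (+ μ) (+ ι) ≤ + 2 * maxE (order μ ι k) k
Φ₀-slope₂≤twice-maxE μ ι k with ≤-total (+ k + + 2) (+ 2 * + μ + + ι)
... | inj₁ k+2≤m = ≤-trans (Φ₀-slope₂≤lowerE₂ (+ k) (+ μ) (+ ι) (+order μ ι k) (τ₂-penalty≥0 μ))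
  (lowerE₂≤twice-maxE (order μ ι k) k (μ ℕ.+ k ℕ.+ k)
    (E₂-defined (+ k) (+ μ) (+ ι) (+order μ ι k) k+2≤m))
  where
  τ₂-penalty≥0 : ∀ μ → 0ℤ ≤ τ₂-penalty μ
  τ₂-penalty≥0 zero    = 0≤+ 2
  τ₂-penalty≥0 (suc _) = 0≤+ 0
Φ₀-slope₂≤twice-maxE zero    ι k | inj₂ _ =
  ≤-trans (Φ₀-slope₂≤twiceE₃-at-μ=0 (+ k) (+ ι) (+order 0 ι k))
    (twiceE₃≤twice-maxE (order 0 ι k) k)
Φ₀-slope₂≤twice-maxE (suc μ) ι k | inj₂ m≤k+2 =
  ≤-trans (Φ₀-slope₂≤twiceE₃ (+ k) (+ suc μ) (+ ι) (+order (suc μ) ι k) (+≤+ (s≤s z≤n)) m≤k+2)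
    (twiceE₃≤twice-maxE (order (suc μ) ι k) k)

Φ₀-slope₃≤twice-maxE : ∀ μ ι k → 8406 ℕ.≤ order μ ι k →
  Φ₀ (+ k) (slope₃ (+ μ) (+ ι)) (+ μ) (+ ι) ≤ + 2 * maxE (order μ ι k) k
Φ₀-slope₃≤twice-maxE μ ι k n≥8406 with ≤-total (+ μ + + ι) (+ 43)
... | inj₁ s≤43 = ≤-trans (Φ₀-slope₃≤lowerE₄ (+ k) (+ μ) (+ ι) (+order μ ι k) s≤43 (+≤+ n≥8406))
  (lowerE₄≤twice-maxE (order μ ι k) k (3k≤order μ ι k)
    (E₄-defined (+ k) (+ μ) (+ ι) (+order μ ι k) s≤43 (+≤+ n≥8406)))
... | inj₂ 43≤s with ≤-total (+ k + + 23) (+ 2 * + μ + + 2 * + ι)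
...   | inj₁ k+23≤2s = ≤-trans (Φ₀-slope₃≤lowerE₁ (+ k) (+ μ) (+ ι) (+order μ ι k) k+23≤2s)
  (lowerE₁≤twice-maxE (order μ ι k) k (μ ℕ.+ k) (k≤order μ ι k))
...   | inj₂ 2s≤k+23 = ≤-trans (Φ₀-slope₃≤twiceE₃ (+ k) (+ μ) (+ ι) (+order μ ι k) 43≤s 2s≤k+23)
  (twiceE₃≤twice-maxE (order μ ι k) k)

Φ₀-slope≤twice-maxE : ∀ μ ι k → 8406 ℕ.≤ order μ ι k →
  Φ₀ (+ k) (slope μ ι) (+ μ) (+ ι) ≤ + 2 * maxE (order μ ι k) k
Φ₀-slope≤twice-maxE μ ι k n≥8406 with ⊔-sel (slope₂ (τ₂-penalty μ) (+ μ) (+ ι)) (slope₃ (+ μ) (+ ι))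
... | inj₁ slope≡slope₂ rewrite slope≡slope₂ = Φ₀-slope₂≤twice-maxE μ ι k
... | inj₂ slope≡slope₃ rewrite slope≡slope₃ = Φ₀-slope₃≤twice-maxE μ ι k n≥8406

Φ≤twice-maxE : ∀ μ ι k a → a ℕ.≤ k → 8406 ℕ.≤ order μ ι k →
  Φ (+ k) (+ a) (slope μ ι) (+ μ) (+ ι) ≤ + 2 * maxE (order μ ι k) k
Φ≤twice-maxE μ ι k a a≤k n≥8406 with Φ-convex (slope μ ι) (+ μ) (+ ι) (0≤+ a) (+≤+ a≤k)
... | inj₁ Φ≤Φ₀ = ≤-trans Φ≤Φ₀ (Φ₀-slope≤twice-maxE μ ι k n≥8406)
... | inj₂ Φ≤Φ₁ = ≤-trans Φ≤Φ₁ (Φ₁≤twice-maxE μ ι k)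

lemma6p1 : (n k τ₁ τ₂ τ₃ τ₄ μ ι : ℕ) → 8406 ℕ.≤ n →
    InF n k τ₁ τ₂ τ₃ τ₄ μ ι →
    g-s τ₁ τ₂ τ₃ τ₄ μ ι ≤ maxE n k
lemma6p1 _ _ τ₁ τ₂ τ₃ τ₄ μ ι n≥8406 (refl , refl) = *-cancelˡ-≤-pos _ _ (+ 2) (≤-trans
  (twice-g-s≤Φ τ₁ τ₂ τ₃ τ₄ μ ι (i≤i⊔j _ _) (i≤j⊔i _ _))
  (Φ≤twice-maxE μ ι (τ₁ ℕ.+ τ₂ ℕ.+ τ₃ ℕ.+ τ₄) τ₁ τ₁≤k n≥8406))
  where
  τ₁≤k : τ₁ ℕ.≤ τ₁ ℕ.+ τ₂ ℕ.+ τ₃ ℕ.+ τ₄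
  τ₁≤k = ℕ.≤-trans (ℕ.m≤m+n τ₁ τ₂) (ℕ.≤-trans (ℕ.m≤m+n _ τ₃) (ℕ.m≤m+n _ τ₄))
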